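{- Let $n\in\mathbb{N}$. The relation $\sim$ on $\mathcal{A}_n^*$, defined by $u\sim v$ iff there is a quasi-crystal isomorphism $\theta:\Gamma_n(u)\to\Gamma_n(v)$ with $\theta(u)=v$, is a congruence on the free monoid $\mathcal{A}_n^*$.
   Context: $\mathcal{A}_n=\{1<\dots<n\}$; $\mathrm{wt}(u)=(|u|_1,\dots,|u|_n)$. For $i\in\{1,\dots,n-1\}$, a word $u$ has an $i$-inversion if it contains a letter $i+1$ to the left of a letter $i$. Quasi-Kashiwara operators: if $u$ has an $i$-inversion, $e_i(u)$ and $f_i(u)$ are undefined; otherwise $e_i(u)$ is $u$ with its leftmost letter $i+1$ replaced by $i$ (undefined if there is no $i+1$), and $f_i(u)$ is $u$ with its rightmost letter $i$ replaced by $i+1$ (undefined if there is no $i$). The quasi-crystal graph $\Gamma_n$ has vertex set $\mathcal{A}_n^*$ and an edge $u\to f_i(u)$ labelled $i$ whenever defined; $\Gamma_n(u)$ is the connected component containing $u$. A quasi-crystal isomorphism between components is a weight-preserving bijection such that $x\to y$ is an edge labelled $i$ iff the images are joined by an edge labelled $i$. A congruence is an equivalence relation compatible with concatenation on both sides. -}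

module Defs where

open import Data.Nat using (ℕ; zero; suc; _<_; _≡ᵇ_)
open import Data.Nat.Properties using (<-trans; n<1+n)
open import Data.Fin using (Fin; toℕ; fromℕ<)
open import Data.Fin.Properties using (_≟_)
open import Data.Bool using (Bool; true; false; if_then_else_; _∨_; _∧_)
open import Data.List using (List; []; _∷_; _++_)
open import Data.Maybe using (Maybe; just; nothing)
open import Data.Product using (∃; ∃-syntax; _×_; _,_)
open import Relation.Nullary using (does)
open import Relation.Binary.PropositionalEquality using (_≡_)
open import Relation.Binary.Structures using (IsEquivalence)
open import Relation.Binary.Construct.Closure.ReflexiveTransitive using (Star)
open import Relation.Binary.Construct.Closure.Symmetric using (SymClosure)

-- Alphabet A_n = Fin n : the letter k ∈ {1,…,n} is represented by the Fin n element k-1.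
-- Words are lists; A_n^* = List (Fin n).
Word : ℕ → Set
Word n = List (Fin n)

wt : ∀ {n} → Word n → Fin n → ℕ
wt [] a = 0
wt (x ∷ xs) a = if does (x ≟ a) then suc (wt xs a) else wt xs a

-- A label i ∈ {1,…,n-1} is represented by j = i-1 : ℕ together with a proof that suc j < n,
-- so that letter i is (the Fin n element with value) j and letter i+1 is suc j.

hasLetter : ∀ {n} → ℕ → Word n → Bool
hasLetter j [] = false
hasLetter j (x ∷ xs) = (toℕ x ≡ᵇ j) ∨ hasLetter j xs

hasInv : ∀ {n} → ℕ → Word n → Bool
hasInv j [] = false
hasInv j (x ∷ xs) = ((toℕ x ≡ᵇ suc j) ∧ hasLetter j xs) ∨ hasInv j xs

replaceRightmost : ∀ {n} → ℕ → Fin n → Word n → Maybe (Word n)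
replaceRightmost j b [] = nothing
replaceRightmost j b (x ∷ xs) with replaceRightmost j b xs
... | just ys = just (x ∷ ys)
... | nothing = if toℕ x ≡ᵇ j then just (b ∷ xs) else nothing

replaceLeftmost : ∀ {n} → ℕ → Fin n → Word n → Maybe (Word n)
replaceLeftmost j b [] = nothing
replaceLeftmost j b (x ∷ xs) =
  if toℕ x ≡ᵇ suc j then just (b ∷ xs)
  else (Data.Maybe.map (x ∷_) (replaceLeftmost j b xs))

letterSuc : ∀ {n} j → suc j < n → Fin n
letterSuc j p = fromℕ< p

letter : ∀ {n} j → suc j < n → Fin n
letter j p = fromℕ< (<-trans (n<1+n j) p)

fOp : ∀ {n} (j : ℕ) → suc j < n → Word n → Maybe (Word n)
fOp j p u = if hasInv j u then nothing else replaceRightmost j (letterSuc j p) u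

eOp : ∀ {n} (j : ℕ) → suc j < n → Word n → Maybe (Word n)
eOp j p u = if hasInv j u then nothing else replaceLeftmost j (letter j p) u

Edge : ∀ {n} → Word n → Word n → Set
Edge {n} u w = ∃[ j ] ∃[ p ] (fOp {n} j p u ≡ just w)

Connected : ∀ {n} → Word n → Word n → Set
Connected u w = Star (SymClosure Edge) u w

-- quasi-crystal isomorphism θ : Γ_n(u) → Γ_n(v) with θ(u) = v.
-- θ and its inverse ψ are given as functions on words; only their
-- restrictions to the components matter.
record QIso {n} (u v : Word n) : Set where
  field
    θ : Word n → Word n
    ψ : Word n → Word n
    θ-into : ∀ x → Connected u x → Connected v (θ x)
    ψ-into : ∀ y → Connected v y → Connected u (ψ y)
    ψθ : ∀ x → Connected u x → ψ (θ x) ≡ x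
    θψ : ∀ y → Connected v y → θ (ψ y) ≡ y
    weight : ∀ x → Connected u x → ∀ a → wt (θ x) a ≡ wt x a
    edges : ∀ x y → Connected u x → Connected u y →
            ∀ j (p : suc j < n) →
            (fOp j p x ≡ just y → fOp j p (θ x) ≡ just (θ y)) ×
            (fOp j p (θ x) ≡ just (θ y) → fOp j p x ≡ just y)
    base : θ u ≡ v

_∼_ : ∀ {n} → Word n → Word n → Set
u ∼ v = QIso u v

IsCongruence : ∀ {n} → (Word n → Word n → Set) → Set
IsCongruence {n} R =
  IsEquivalence R ×
  (∀ (u v w : Word n) → R u v → R (w ++ u) (w ++ v)) ×
  (∀ (u v w : Word n) → R u v → R (u ++ w) (v ++ w))

-- A quasi-Kashiwara operator applied to a concatenation ab acts on exactly one factor: it is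
-- undefined if ab has an i-inversion, acts on b if b contains a letter i, and acts on a otherwise.
-- Whether ab has an i-inversion depends only on the inversions of a and b and on which letters
-- they contain, and a quasi-crystal isomorphism preserves all of these: letters through the
-- weight, and the absence of i-inversions because on a word containing i the operator f_i is
-- defined exactly when there is no i-inversion. Hence the component of
-- ab is the set of products of elements of the components of a and b, and two isomorphisms
-- θ : Γ(a) → Γ(a'), η : Γ(b) → Γ(b') combine factorwise into an isomorphism Γ(ab) → Γ(a'b').
module Submission where

open import Data.Bool using (true; false; _∨_; _∧_)
open import Data.Bool.Properties
  using (∨-zeroʳ; ∧-zeroʳ; ∨-assoc; ∨-identityʳ; ∨-conicalˡ; ∨-conicalʳ; T-≡; ⇔→≡)
open import Data.Fin using (Fin; toℕ)
open import Data.Fin.Properties using (_≟_)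
open import Data.List using (_∷_; []; _++_; length; take; drop)
open import Data.List.Properties using (length-++-≤ˡ; length-take; take++drop≡id; ∷-injective)
open import Data.Maybe using (just; nothing)
import Data.Maybe as Maybe
open import Data.Maybe.Properties using (just-injective)
open import Data.Nat using (ℕ; suc; _+_; _<_; _≤_; _≡ᵇ_; s≤s; z≤n)
open import Data.Nat.Properties using (≡ᵇ⇒≡; ≡⇒≡ᵇ; suc-injective; m≤n⇒m⊓n≡m)
open import Data.Product using (∃; ∃₂; _×_; _,_; proj₁)
open import Function using (_∘_)
open import Function.Bundles using (mk⇔; Equivalence)
open import Relation.Nullary using (yes; no; contradiction)
open import Relation.Binary.PropositionalEquality
  using (_≡_; refl; sym; trans; cong; cong₂; subst; module ≡-Reasoning)
open import Relation.Binary.Construct.Closure.ReflexiveTransitive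
  using (ε; _◅_; _◅◅_; return; reverse)
open import Relation.Binary.Construct.Closure.Symmetric using (SymClosure; fwd; bwd; symmetric)
open import Defs

private
  variable
    n : ℕ
    a b c d s s' t t' u v w x y : Word n

∨-shuffle : ∀ p q r s t → (p ∨ q) ∨ (r ∨ s ∨ (t ∧ q)) ≡ (p ∨ r) ∨ s ∨ q
∨-shuffle true  q     r s t = refl
∨-shuffle false true  r s t = sym (trans (cong (r ∨_) (∨-zeroʳ s)) (∨-zeroʳ r))
∨-shuffle false false r s t = cong (λ z → r ∨ s ∨ z) (∧-zeroʳ t)

hasLetter-++ : ∀ k (a b : Word n) → hasLetter k (a ++ b) ≡ hasLetter k a ∨ hasLetter k b
hasLetter-++ k []      b = refl
hasLetter-++ k (x ∷ a) b =
  trans (cong ((toℕ x ≡ᵇ k) ∨_) (hasLetter-++ k a b)) (sym (∨-assoc (toℕ x ≡ᵇ k) _ _))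

hasInv-++ : ∀ j (a b : Word n) →
  hasInv j (a ++ b) ≡ hasInv j a ∨ hasInv j b ∨ (hasLetter (suc j) a ∧ hasLetter j b)
hasInv-++ j []      b = sym (∨-identityʳ _)
hasInv-++ j (x ∷ a) b with toℕ x ≡ᵇ suc j
... | false = hasInv-++ j a b
... | true rewrite hasLetter-++ j a b | hasInv-++ j a b =
  ∨-shuffle (hasLetter j a) (hasLetter j b) (hasInv j a) (hasInv j b) (hasLetter (suc j) a)

hasInv-++-cong : ∀ j {a a' b b' : Word n} →
  hasInv j a' ≡ hasInv j a → hasInv j b' ≡ hasInv j b →
  hasLetter (suc j) a' ≡ hasLetter (suc j) a → hasLetter j b' ≡ hasLetter j b →
  hasInv j (a' ++ b') ≡ hasInv j (a ++ b)
hasInv-++-cong j {a} {a'} {b} {b'} e₁ e₂ e₃ e₄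
  rewrite hasInv-++ j a' b' | hasInv-++ j a b | e₁ | e₂ | e₃ | e₄ = refl

noInv-++ : ∀ j (a b : Word n) → hasInv j (a ++ b) ≡ false →
  hasInv j a ≡ false × hasInv j b ≡ false
noInv-++ j a b e =
  ∨-conicalˡ (hasInv j a) _ e′ , ∨-conicalˡ (hasInv j b) _ (∨-conicalʳ (hasInv j a) _ e′)
  where e′ = trans (sym (hasInv-++ j a b)) e

noLetter⇒noInv : ∀ j (x : Word n) → hasLetter j x ≡ false → hasInv j x ≡ false
noLetter⇒noInv j []      e = refl
noLetter⇒noInv j (y ∷ x) e =
  cong₂ _∨_ (trans (cong (_ ∧_) noLetter) (∧-zeroʳ _)) (noLetter⇒noInv j x noLetter)
  where noLetter = ∨-conicalʳ _ _ e

wt-++ : ∀ (a b : Word n) c → wt (a ++ b) c ≡ wt a c + wt b c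
wt-++ []      b c = refl
wt-++ (x ∷ a) b c with x ≟ c
... | yes _ = cong suc (wt-++ a b c)
... | no  _ = wt-++ a b c

wt-∷-self : ∀ y (x : Word n) → 0 < wt (y ∷ x) y
wt-∷-self y x with y ≟ y
... | yes _   = s≤s z≤n
... | no y≢y = contradiction refl y≢y

wt-∷-pos : ∀ y (x : Word n) {ℓ} → 0 < wt x ℓ → 0 < wt (y ∷ x) ℓ
wt-∷-pos y x {ℓ} pos with y ≟ ℓ
... | yes _ = s≤s z≤n
... | no  _ = pos

hasLetter⇒wt : ∀ k (x : Word n) → hasLetter k x ≡ true → ∃ λ ℓ → toℕ ℓ ≡ k × 0 < wt x ℓ
hasLetter⇒wt k (y ∷ x) e with toℕ y ≡ᵇ k in ey
... | true  = y , ≡ᵇ⇒≡ _ _ (Equivalence.from T-≡ ey) , wt-∷-self y x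
... | false with ℓ , kℓ , pos ← hasLetter⇒wt k x e = ℓ , kℓ , wt-∷-pos y x pos

wt⇒hasLetter : ∀ k (x : Word n) ℓ → toℕ ℓ ≡ k → 0 < wt x ℓ → hasLetter k x ≡ true
wt⇒hasLetter k (y ∷ x) ℓ refl pos with y ≟ ℓ
... | yes refl = cong (_∨ hasLetter k x) (Equivalence.to T-≡ (≡⇒≡ᵇ (toℕ y) _ refl))
... | no  _    = trans (cong ((toℕ y ≡ᵇ k) ∨_) (wt⇒hasLetter k x ℓ refl pos)) (∨-zeroʳ _)

hasLetter-cong-wt : ∀ k → (∀ ℓ → wt x ℓ ≡ wt y ℓ) → hasLetter k x ≡ hasLetter k y
hasLetter-cong-wt {x = x} {y = y} k same = ⇔→≡ (mk⇔ (move {x} {y} same) (move {y} {x} (sym ∘ same)))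
  where
  move : ∀ {x y} → (∀ ℓ → wt x ℓ ≡ wt y ℓ) → hasLetter k x ≡ true → hasLetter k y ≡ true
  move {x} {y} same e with hasLetter⇒wt k x e
  ... | ℓ , kℓ , pos = wt⇒hasLetter k y ℓ kℓ (subst (0 <_) (same ℓ) pos)

module _ (j : ℕ) (ℓ : Fin n) where

  replaceRightmost-++-just : ∀ a {b d} → replaceRightmost j ℓ b ≡ just d →
    replaceRightmost j ℓ (a ++ b) ≡ just (a ++ d)
  replaceRightmost-++-just []      e = e
  replaceRightmost-++-just (x ∷ a) {b} e
    with replaceRightmost j ℓ (a ++ b) | replaceRightmost-++-just a {b} e
  ... | _ | refl = refl

  replaceRightmost-++-nothing : ∀ a {b} → replaceRightmost j ℓ b ≡ nothing →
    replaceRightmost j ℓ (a ++ b) ≡ Maybe.map (_++ b) (replaceRightmost j ℓ a)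
  replaceRightmost-++-nothing []      e = e
  replaceRightmost-++-nothing (x ∷ a) {b} e
    with replaceRightmost j ℓ (a ++ b) | replaceRightmost-++-nothing a {b} e
  ... | _ | refl with replaceRightmost j ℓ a
  ...   | just _  = refl
  ...   | nothing with toℕ x ≡ᵇ j
  ...     | true  = refl
  ...     | false = refl

  replaceRightmost-nothing : ∀ x → replaceRightmost j ℓ x ≡ nothing → hasLetter j x ≡ false
  replaceRightmost-nothing []      e = refl
  replaceRightmost-nothing (y ∷ x) e with replaceRightmost j ℓ x in ex
  ... | nothing with toℕ y ≡ᵇ j
  ...   | false = replaceRightmost-nothing x ex

  replaceRightmost-noLetter : ∀ x → hasLetter j x ≡ false → replaceRightmost j ℓ x ≡ nothing
  replaceRightmost-noLetter []      e = refl
  replaceRightmost-noLetter (y ∷ x) e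
    rewrite replaceRightmost-noLetter x (∨-conicalʳ _ _ e) | ∨-conicalˡ (toℕ y ≡ᵇ j) _ e = refl

  replaceRightmost-length : ∀ x → replaceRightmost j ℓ x ≡ just y → length y ≡ length x
  replaceRightmost-length (z ∷ x) e with replaceRightmost j ℓ x in ex
  replaceRightmost-length (z ∷ x) refl | just _ = cong suc (replaceRightmost-length x ex)
  ... | nothing with toℕ z ≡ᵇ j
  replaceRightmost-length (z ∷ x) refl | nothing | true = refl

module _ {j : ℕ} (p : suc j < n) where

  fOp-noInv : ∀ x → hasInv j x ≡ false → fOp j p x ≡ replaceRightmost j (letterSuc j p) x
  fOp-noInv x e rewrite e = refl

  fOp-subst : ∀ {x′ y′ : Word n} → x ≡ x′ → y ≡ y′ → fOp j p x ≡ just y → fOp j p x′ ≡ just y′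
  fOp-subst refl refl e = e

  fOp-just⇒noInv : ∀ x → fOp j p x ≡ just y → hasInv j x ≡ false
  fOp-just⇒noInv x e with hasInv j x
  ... | false = refl

  fOp-length : ∀ x → fOp j p x ≡ just y → length y ≡ length x
  fOp-length x e with hasInv j x
  ... | false = replaceRightmost-length j _ x e

  fOp-defined : hasInv j x ≡ false → hasLetter j x ≡ true → ∃ λ y → fOp j p x ≡ just y
  fOp-defined {x = x} noInv letter rewrite noInv with replaceRightmost j (letterSuc j p) x in e
  ... | just y  = y , refl
  ... | nothing with () ← trans (sym letter) (replaceRightmost-nothing j _ x e)

  -- f_i changes the rightmost letter i of a ++ b, which lies in b unless b has none.
  data ConcatStep (a b : Word n) : Word n → Word n → Set where
    stepʳ : fOp j p b ≡ just d → ConcatStep a b a d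
    stepˡ : hasLetter j b ≡ false → fOp j p a ≡ just c → ConcatStep a b c b

  fOp-++⁺ : hasInv j (a ++ b) ≡ false → ConcatStep a b c d → fOp j p (a ++ b) ≡ just (c ++ d)
  fOp-++⁺ {a = a} {b = b} noInv step with noInv-++ j a b noInv
  fOp-++⁺ {a = a} {b = b} noInv (stepʳ fb) | _ , noInvᵇ =
    trans (fOp-noInv (a ++ b) noInv)
      (replaceRightmost-++-just j _ a (trans (sym (fOp-noInv b noInvᵇ)) fb))
  fOp-++⁺ {a = a} {b = b} noInv (stepˡ noLetter fa) | noInvᵃ , _ =
    trans (fOp-noInv (a ++ b) noInv)
      (trans (replaceRightmost-++-nothing j _ a (replaceRightmost-noLetter j _ b noLetter))
             (cong (Maybe.map (_++ b)) (trans (sym (fOp-noInv a noInvᵃ)) fa)))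

  fOp-++⁻ : fOp j p (a ++ b) ≡ just y →
    hasInv j (a ++ b) ≡ false × ∃₂ λ c d → y ≡ c ++ d × ConcatStep a b c d
  fOp-++⁻ {a = a} {b = b} e
    with noInv ← fOp-just⇒noInv (a ++ b) e
    with noInvᵃ , noInvᵇ ← noInv-++ j a b noInv
    with e′ ← trans (sym (fOp-noInv (a ++ b) noInv)) e
    with replaceRightmost j (letterSuc j p) b in eb
  ... | just d = noInv , a , d ,
    just-injective (trans (sym e′) (replaceRightmost-++-just j _ a eb)) ,
    stepʳ (trans (fOp-noInv b noInvᵇ) eb)
  ... | nothing
    with e″ ← trans (sym e′) (replaceRightmost-++-nothing j _ a eb)
    with replaceRightmost j (letterSuc j p) a in ea
  ...   | just c = noInv , c , b , just-injective e″ ,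
    stepˡ (replaceRightmost-nothing j _ b eb) (trans (fOp-noInv a noInvᵃ) ea)
  ...   | nothing with () ← e″

  ConcatStep-length : ConcatStep a b c d → length c ≡ length a
  ConcatStep-length (stepʳ _)    = refl
  ConcatStep-length {a = a} (stepˡ _ fa) = fOp-length a fa

  ConcatStep-connected : ConcatStep a b c d → Connected a c × Connected b d
  ConcatStep-connected (stepʳ fb)   = ε , return (fwd (j , p , fb))
  ConcatStep-connected (stepˡ _ fa) = return (fwd (j , p , fa)) , ε

++-cancel-length : ∀ (a c : Word n) → length a ≡ length c → a ++ b ≡ c ++ d → a ≡ c × b ≡ d
++-cancel-length []      []      _   e = refl , e
++-cancel-length (x ∷ a) (y ∷ c) len e with refl , e′ ← ∷-injective e
  with refl , refl ← ++-cancel-length a c (suc-injective len) e′ = refl , refl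

length-take-≤ : ∀ {k} (y : Word n) → k ≤ length y → length (take k y) ≡ k
length-take-≤ {k = k} y k≤ = trans (length-take k y) (m≤n⇒m⊓n≡m k≤)

-- f_i preserves length, so the source of an edge into a ++ b splits at |a|.
fOp-into-++ : ∀ {j} (p : suc j < n) → fOp j p y ≡ just (a ++ b) →
  ∃₂ λ c d → y ≡ c ++ d × ConcatStep p c d a b
fOp-into-++ {y = y} {a = a} {b = b} p e
  with _ , c′ , d′ , split , step ←
         fOp-++⁻ p (subst (λ z → fOp _ p z ≡ just (a ++ b)) (sym (take++drop≡id (length a) y)) e)
  with refl , refl ← ++-cancel-length c′ a
         (trans (ConcatStep-length p step)
                (length-take-≤ y (subst (length a ≤_) (fOp-length p y e) (length-++-≤ˡ a))))
         (sym split)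
  = take (length a) y , drop (length a) y , sym (take++drop≡id (length a) y) , step

SymEdge-length : SymClosure Edge x y → length x ≡ length y
SymEdge-length {x = x} (fwd (_ , p , e)) = sym (fOp-length p x e)
SymEdge-length {y = y} (bwd (_ , p , e)) = fOp-length p y e

Connected-length : Connected x y → length x ≡ length y
Connected-length ε            = refl
Connected-length (edge ◅ r) = trans (SymEdge-length edge) (Connected-length r)

Connected-sym : Connected x y → Connected y x
Connected-sym = reverse (symmetric Edge)

SymEdge-++⁻ : SymClosure Edge (s ++ t) y → ∃₂ λ c d → y ≡ c ++ d × Connected s c × Connected t d
SymEdge-++⁻ (fwd (_ , p , e)) with _ , c , d , refl , step ← fOp-++⁻ p e =
  c , d , refl , ConcatStep-connected p step
SymEdge-++⁻ {s = s} {t = t} {y = y} (bwd (_ , p , e))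
  with c , d , refl , step ← fOp-into-++ {y = y} {a = s} {b = t} p e
  with cs , dt ← ConcatStep-connected p step = c , d , refl , Connected-sym cs , Connected-sym dt

Connected-++⁻ : Connected (s ++ t) x → ∃₂ λ a b → x ≡ a ++ b × Connected s a × Connected t b
Connected-++⁻ {s = s} {t = t} ε = s , t , refl , ε , ε
Connected-++⁻ (edge ◅ r)
  with c , d , refl , sc , td ← SymEdge-++⁻ edge
  with a , b , refl , ca , db ← Connected-++⁻ r
  = a , b , refl , sc ◅◅ ca , td ◅◅ db

∼-refl : u ∼ u
∼-refl = record
  { θ = λ x → x ; ψ = λ x → x ; θ-into = λ _ c → c ; ψ-into = λ _ c → c
  ; ψθ = λ _ _ → refl ; θψ = λ _ _ → refl ; weight = λ _ _ _ → refl
  ; edges = λ _ _ _ _ _ _ → (λ e → e) , (λ e → e) ; base = refl }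

∼-sym : u ∼ v → v ∼ u
∼-sym {u = u} I = record
  { θ = ψ ; ψ = θ ; θ-into = ψ-into ; ψ-into = θ-into ; ψθ = θψ ; θψ = ψθ
  ; weight = λ y cy ℓ → trans (sym (weight (ψ y) (ψ-into y cy) ℓ)) (cong (λ z → wt z ℓ) (θψ y cy))
  ; edges = λ x y cx cy j p →
      let back , forth = edges (ψ x) (ψ y) (ψ-into x cx) (ψ-into y cy) j p
      in forth ∘ fOp-subst p (sym (θψ x cx)) (sym (θψ y cy))
       , fOp-subst p (θψ x cx) (θψ y cy) ∘ back
  ; base = subst (λ z → ψ z ≡ u) base (ψθ u ε) }
  where open QIso I

∼-trans : u ∼ v → v ∼ w → u ∼ w
∼-trans I J = record
  { θ = J.θ ∘ I.θ ; ψ = I.ψ ∘ J.ψ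
  ; θ-into = λ x cx → J.θ-into (I.θ x) (I.θ-into x cx)
  ; ψ-into = λ y cy → I.ψ-into (J.ψ y) (J.ψ-into y cy)
  ; ψθ = λ x cx → trans (cong I.ψ (J.ψθ (I.θ x) (I.θ-into x cx))) (I.ψθ x cx)
  ; θψ = λ y cy → trans (cong J.θ (I.θψ (J.ψ y) (J.ψ-into y cy))) (J.θψ y cy)
  ; weight = λ x cx ℓ → trans (J.weight (I.θ x) (I.θ-into x cx) ℓ) (I.weight x cx ℓ)
  ; edges = λ x y cx cy j p →
      let I-to , I-from = I.edges x y cx cy j p
          J-to , J-from = J.edges (I.θ x) (I.θ y) (I.θ-into x cx) (I.θ-into y cy) j p
      in J-to ∘ I-to , I-from ∘ J-from
  ; base = trans (cong J.θ I.base) J.base }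
  where module I = QIso I
        module J = QIso J

EdgePreserving : Word n → (Word n → Word n) → Set
EdgePreserving {n} u θ = ∀ {x y} → Connected u x →
  ∀ j (p : suc j < n) → fOp j p x ≡ just y → fOp j p (θ x) ≡ just (θ y)

map-component : ∀ (θ : Word n → Word n) → θ u ≡ v → EdgePreserving u θ →
  Connected u x → Connected v (θ x)
map-component {u = u} θ base pres cx = subst (λ z → Connected z (θ _)) base (along ε cx)
  where
  along : Connected u y → Connected y x → Connected (θ y) (θ x)
  along cy ε = ε
  along cy (fwd (j , p , e) ◅ r) = fwd (j , p , pres cy j p e) ◅ along cy′ r
    where cy′ = cy ◅◅ return (fwd (j , p , e))
  along cy (bwd (j , p , e) ◅ r) = bwd (j , p , pres cy′ j p e) ◅ along cy′ r
    where cy′ = cy ◅◅ return (bwd (j , p , e))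

-- The reverse edge condition of QIso follows by applying ψ.
mkQIso : (θ ψ : Word n → Word n) → θ u ≡ v → ψ v ≡ u →
  EdgePreserving u θ → EdgePreserving v ψ →
  (∀ x → Connected u x → ψ (θ x) ≡ x) → (∀ y → Connected v y → θ (ψ y) ≡ y) →
  (∀ x → Connected u x → ∀ ℓ → wt (θ x) ℓ ≡ wt x ℓ) → u ∼ v
mkQIso θ ψ θ-base ψ-base θ-pres ψ-pres ψθ θψ weight = record
  { θ = θ ; ψ = ψ
  ; θ-into = λ _ → map-component θ θ-base θ-pres
  ; ψ-into = λ _ → map-component ψ ψ-base ψ-pres
  ; ψθ = ψθ ; θψ = θψ ; weight = weight
  ; edges = λ x y cx cy j p →
      θ-pres cx j p
    , fOp-subst p (ψθ x cx) (ψθ y cy) ∘ ψ-pres (map-component θ θ-base θ-pres cx) j p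
  ; base = θ-base }

module _ (I : u ∼ v) where
  open QIso I

  θ-edgePreserving : EdgePreserving u θ
  θ-edgePreserving cx j p e = proj₁ (edges _ _ cx (cx ◅◅ return (fwd (j , p , e))) j p) e

  hasLetter-θ : ∀ k → Connected u x → hasLetter k (θ x) ≡ hasLetter k x
  hasLetter-θ {x = x} k cx = hasLetter-cong-wt {x = θ x} {y = x} k (weight x cx)

  noInv-θ : ∀ {j} → suc j < _ → Connected u x → hasInv j x ≡ false → hasInv j (θ x) ≡ false
  noInv-θ {x = x} {j} p cx noInv with hasLetter j x in letter
  ... | true with y , e ← fOp-defined p {x = x} noInv letter =
    fOp-just⇒noInv p (θ x) (θ-edgePreserving cx j p e)
  ... | false = noLetter⇒noInv j (θ x) (trans (hasLetter-θ j cx) letter)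

hasInv-θ : ∀ {j} (I : u ∼ v) → suc j < _ → Connected u x → hasInv j (QIso.θ I x) ≡ hasInv j x
hasInv-θ {x = x} {j = j} I p cx = ⇔→≡ (mk⇔ reflect (noInv-θ I p cx))
  where
  open QIso I
  reflect : hasInv j (θ x) ≡ false → hasInv j x ≡ false
  reflect noInv =
    subst (λ z → hasInv j z ≡ false) (ψθ x cx) (noInv-θ (∼-sym I) p (θ-into x cx) noInv)

mapFactors : ℕ → (Word n → Word n) → (Word n → Word n) → Word n → Word n
mapFactors k f g x = f (take k x) ++ g (drop k x)

mapFactors-++ : ∀ {k} (f g : Word n → Word n) a b → length a ≡ k →
  mapFactors k f g (a ++ b) ≡ f a ++ g b
mapFactors-++ f g []      b refl = refl
mapFactors-++ f g (x ∷ a) b refl = mapFactors-++ (f ∘ (x ∷_)) g a b refl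

-- All words of Γ(s) have length |s|, so splitting at |s| recovers the factors in Γ(s ++ t).
⊗-map : {s s' t t' : Word n} → s ∼ s' → t ∼ t' → Word n → Word n
⊗-map {s = s} I J = mapFactors (length s) (QIso.θ I) (QIso.θ J)

module _ {s s' t t' : Word n} (I : s ∼ s') (J : t ∼ t') where
  private
    module I = QIso I
    module J = QIso J

  ⊗-map-++ : Connected s a → ⊗-map I J (a ++ b) ≡ I.θ a ++ J.θ b
  ⊗-map-++ ca = mapFactors-++ I.θ J.θ _ _ (sym (Connected-length ca))

  ⊗-map-base : ⊗-map I J (s ++ t) ≡ s' ++ t'
  ⊗-map-base = trans (⊗-map-++ ε) (cong₂ _++_ I.base J.base)

  ConcatStep-θ : ∀ {j} (p : suc j < _) → Connected s a → Connected t b →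
    ConcatStep p a b c d → ConcatStep p (I.θ a) (J.θ b) (I.θ c) (J.θ d)
  ConcatStep-θ {j = j} p ca cb (stepʳ fb)          = stepʳ (θ-edgePreserving J cb j p fb)
  ConcatStep-θ {j = j} p ca cb (stepˡ noLetter fa) =
    stepˡ (trans (hasLetter-θ J j cb) noLetter) (θ-edgePreserving I ca j p fa)

  ⊗-map-edgePreserving : EdgePreserving (s ++ t) (⊗-map I J)
  ⊗-map-edgePreserving cx j p e
    with a , b , refl , ca , cb ← Connected-++⁻ cx
    with noInv , c , d , refl , step ← fOp-++⁻ p e
    with cc , _ ← ConcatStep-connected p step
    rewrite ⊗-map-++ {b = b} ca | ⊗-map-++ {b = d} (ca ◅◅ cc) =
    fOp-++⁺ p (trans sameInv noInv) (ConcatStep-θ p ca cb step)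
    where
    sameInv : hasInv j (I.θ a ++ J.θ b) ≡ hasInv j (a ++ b)
    sameInv = hasInv-++-cong j {a} {I.θ a} {b} {J.θ b} (hasInv-θ I p ca) (hasInv-θ J p cb)
      (hasLetter-θ I (suc j) ca) (hasLetter-θ J j cb)

  ⊗-map-weight : Connected (s ++ t) x → ∀ ℓ → wt (⊗-map I J x) ℓ ≡ wt x ℓ
  ⊗-map-weight cx ℓ with a , b , refl , ca , cb ← Connected-++⁻ cx = begin
    wt (⊗-map I J (a ++ b)) ℓ      ≡⟨ cong (λ z → wt z ℓ) (⊗-map-++ ca) ⟩
    wt (I.θ a ++ J.θ b) ℓ          ≡⟨ wt-++ (I.θ a) (J.θ b) ℓ ⟩
    wt (I.θ a) ℓ + wt (J.θ b) ℓ    ≡⟨ cong₂ _+_ (I.weight a ca ℓ) (J.weight b cb ℓ) ⟩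
    wt a ℓ + wt b ℓ                ≡⟨ wt-++ a b ℓ ⟨
    wt (a ++ b) ℓ                  ∎
    where open ≡-Reasoning

module _ {s s' t t' : Word n} (I : s ∼ s') (J : t ∼ t') where
  private
    module I = QIso I
    module J = QIso J
    I⁻¹ = ∼-sym I
    J⁻¹ = ∼-sym J

  ⊗-map-inverse : Connected (s ++ t) x → ⊗-map I⁻¹ J⁻¹ (⊗-map I J x) ≡ x
  ⊗-map-inverse cx with a , b , refl , ca , cb ← Connected-++⁻ cx = begin
    ⊗-map I⁻¹ J⁻¹ (⊗-map I J (a ++ b))   ≡⟨ cong (⊗-map I⁻¹ J⁻¹) (⊗-map-++ I J ca) ⟩
    ⊗-map I⁻¹ J⁻¹ (I.θ a ++ J.θ b)       ≡⟨ ⊗-map-++ I⁻¹ J⁻¹ (I.θ-into a ca) ⟩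
    I.ψ (I.θ a) ++ J.ψ (J.θ b)           ≡⟨ cong₂ _++_ (I.ψθ a ca) (J.ψθ b cb) ⟩
    a ++ b                               ∎
    where open ≡-Reasoning

∼-++ : s ∼ s' → t ∼ t' → (s ++ t) ∼ (s' ++ t')
∼-++ I J = mkQIso (⊗-map I J) (⊗-map I⁻¹ J⁻¹)
  (⊗-map-base I J) (⊗-map-base I⁻¹ J⁻¹)
  (⊗-map-edgePreserving I J) (⊗-map-edgePreserving I⁻¹ J⁻¹)
  (λ _ → ⊗-map-inverse I J) (λ _ → ⊗-map-inverse I⁻¹ J⁻¹)
  (λ _ → ⊗-map-weight I J)
  where
  I⁻¹ = ∼-sym I
  J⁻¹ = ∼-sym J

proposition5p6 : (n : ℕ) → IsCongruence {n} _∼_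
proposition5p6 n =
    record { refl = ∼-refl ; sym = ∼-sym ; trans = ∼-trans }
  , (λ u v w I → ∼-++ (∼-refl {u = w}) I)
  , (λ u v w I → ∼-++ I (∼-refl {u = w}))
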